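{- Let $n$ and $a$ be integers with $3\le a\le\left\lfloor\frac{n}{2}\right\rfloor$ and $3a\le n$. Then for every $2$-bounded independent broadcast $f$ on $C(n;1,a)$, $$\sigma(f)\le\left\lfloor\frac{n-|V_f^{2}|}{2}\right\rfloor,$$ where $V_f^{2}=\{v: f(v)=2\}$.
   Context: For integers $n\ge 3$ and $1\le a\le\lfloor n/2\rfloor$, the circulant graph $C(n;1,a)$ has vertex set $\{v_0,\dots,v_{n-1}\}$ and edges $v_iv_{i+1}$ and $v_iv_{i+a}$, subscripts modulo $n$. For a connected graph $G$, a broadcast is a function $f:V(G)\to\{0,\dots,\mathrm{diam}(G)\}$ with $f(v)\le e(v)$ (eccentricity) for all $v$; $V_f^+=\{v:f(v)>0\}$. $f$ is independent if $d(u,v)>\max\{f(u),f(v)\}$ for all distinct $u,v\in V_f^+$. The cost is $\sigma(f)=\sum_v f(v)$. An independent broadcast is $2$-bounded if $f(v)\le 2$ for every vertex $v$. -}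

module Defs where

open import Data.Nat using (ℕ; zero; suc; _+_; _∸_; _⊔_; _≤_; _<_; NonZero)
open import Data.Nat.DivMod using (_%_; m%n<n)
open import Data.Fin using (Fin; toℕ; fromℕ<; _≟_)
open import Data.Bool using (Bool; true; false; _∨_; if_then_else_)
open import Data.List using (List; _∷_; []; map; foldr; allFin; length; filter)
open import Data.Bool.ListAction using (any)
open import Data.Nat.ListAction using (sum)
open import Relation.Nullary.Decidable using (⌊_⌋)
open import Relation.Binary.PropositionalEquality using (_≡_; _≢_)

-- The vertex v_i of C(n;1,a) is represented by i : Fin n.
-- Reduction modulo n.
modN : (n : ℕ) → .{{_ : NonZero n}} → ℕ → Fin n
modN n m = fromℕ< (m%n<n m n)

nbrs : (n a : ℕ) → .{{_ : NonZero n}} → Fin n → List (Fin n)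
nbrs n a i =
  modN n (toℕ i + 1) ∷ modN n (toℕ i + (n ∸ 1)) ∷
  modN n (toℕ i + a) ∷ modN n (toℕ i + (n ∸ a)) ∷ []

reach : (n a : ℕ) → .{{_ : NonZero n}} → ℕ → Fin n → Fin n → Bool
reach n a zero    u v = ⌊ u ≟ v ⌋
reach n a (suc k) u v = reach n a k u v ∨ any (λ w → reach n a k u w) (nbrs n a v)

-- Least k (searching k = 0,1,...,n) with a walk of length ≤ k from u to v:
-- the graph distance d(u,v) in C(n;1,a) (which is connected, so d(u,v) < n).
distFrom : (n a : ℕ) → .{{_ : NonZero n}} → ℕ → ℕ → Fin n → Fin n → ℕ
distFrom n a zero       k u v = k
distFrom n a (suc fuel) k u v =
  if reach n a k u v then k else distFrom n a fuel (suc k) u v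

dist : (n a : ℕ) → .{{_ : NonZero n}} → Fin n → Fin n → ℕ
dist n a u v = distFrom n a n 0 u v

ecc : (n a : ℕ) → .{{_ : NonZero n}} → Fin n → ℕ
ecc n a v = foldr _⊔_ 0 (map (dist n a v) (allFin n))

IsBroadcast : (n a : ℕ) → .{{_ : NonZero n}} → (Fin n → ℕ) → Set
IsBroadcast n a f = ∀ v → f v ≤ ecc n a v

IsIndependent : (n a : ℕ) → .{{_ : NonZero n}} → (Fin n → ℕ) → Set
IsIndependent n a f =
  ∀ u v → u ≢ v → 0 < f u → 0 < f v → f u ⊔ f v < dist n a u v

Is2Bounded : (n : ℕ) → (Fin n → ℕ) → Set
Is2Bounded n f = ∀ v → f v ≤ 2

cost : (n : ℕ) → (Fin n → ℕ) → ℕ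
cost n f = sum (map f (allFin n))

numTwo : (n : ℕ) → (Fin n → ℕ) → ℕ
numTwo n f = length (filter (λ v → f v Data.Nat.≟ 2) (allFin n))

-- For a vertex x, count x and x − 1 when f is positive there, and x + 1, x + a, x − a when f is 2
-- there. Pairs containing x are at distance 1; the others are at distance at most 2 and involve a
-- vertex of strength 2, so independence lets at most one of the five count. Summing over x, each
-- rotation of the window visits every vertex once, which gives 2|V_f^+| + 3|V_f^2| ≤ n, that is
-- 2σ(f) + |V_f^2| ≤ n.

module Submission where

open import Defs
open import Data.Nat using (ℕ; zero; suc; _+_; _∸_; _*_; _≤_; _<_; _⊔_; _/_; _%_; NonZero; z≤n; s≤s; z<s; pred; _<?_; >-nonZero⁻¹)
open import Data.Nat.Properties
open import Data.Nat.DivMod using (%-distribˡ-+; m%n%n≡m%n; %-remove-+ʳ; [m+n]%n≡m%n; m<n⇒m%n≡m; m*n/n≡m; /-monoˡ-≤)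
open import Data.Nat.Divisibility using (_∣_; _∣0; m∣m*n; ∣-reflexive)
open import Data.Nat.ListAction using (sum)
open import Data.Nat.Tactic.RingSolver using (solve-∀)
open import Data.Fin as Fin using (Fin; toℕ)
open import Data.Fin.Properties using (toℕ-injective; toℕ<n; toℕ-fromℕ<)
open import Data.Fin.Permutation using (permutation)
open import Data.List using (List; []; _∷_; map; length; filter; allFin; tabulate)
open import Data.List.Properties using (map-cong; map-tabulate; length-tabulate)
open import Data.List.Membership.Propositional using (_∈_)
open import Data.List.Relation.Unary.Any using (here; there)
open import Data.List.Relation.Unary.All as All using (All; []; _∷_)
open import Data.List.Relation.Unary.AllPairs as AllPairs using (AllPairs; []; _∷_)
open import Data.List.Relation.Unary.Linked using ([-]; _∷_)
open import Data.List.Relation.Unary.Linked.Properties using (Linked⇒AllPairs)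
open import Data.Bool using (Bool; true; false; _∨_)
open import Data.Bool.ListAction using (any)
open import Data.Bool.Properties using (∨-zeroʳ)
open import Data.Product using (_×_; _,_)
open import Data.Empty using (⊥)
open import Function using (_∘_; id; const)
open import Relation.Nullary using (Dec; yes; no; ¬_; contradiction)
open import Relation.Unary using (Decidable)
open import Relation.Binary.PropositionalEquality
import Algebra.Properties.CommutativeMonoid.Sum as CommutativeMonoidSum
open import Algebra.Properties.CommutativeSemigroup +-commutativeSemigroup using (interchange; x∙yz≈y∙xz)

𝟙 : {P : Set} → Dec P → ℕ
𝟙 (yes _) = 1
𝟙 (no _)  = 0

module _ {A : Set} where

  length-filter≡sum-𝟙 : {P : A → Set} (P? : Decidable P) (xs : List A) →
                        length (filter P? xs) ≡ sum (map (𝟙 ∘ P?) xs)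
  length-filter≡sum-𝟙 P? []       = refl
  length-filter≡sum-𝟙 P? (x ∷ xs) with P? x
  ... | yes _ = cong suc (length-filter≡sum-𝟙 P? xs)
  ... | no _  = length-filter≡sum-𝟙 P? xs

  sum-𝟙≡0 : {P : A → Set} (P? : Decidable P) {xs : List A} →
            All (¬_ ∘ P) xs → sum (map (𝟙 ∘ P?) xs) ≡ 0
  sum-𝟙≡0 P? [] = refl
  sum-𝟙≡0 P? {x ∷ _} (¬px ∷ ¬pxs) with P? x
  ... | yes px = contradiction px ¬px
  ... | no _   = sum-𝟙≡0 P? ¬pxs

  sum-𝟙≤1 : {P : A → Set} (P? : Decidable P) {xs : List A} →
            AllPairs (λ x y → P x → P y → ⊥) xs → sum (map (𝟙 ∘ P?) xs) ≤ 1
  sum-𝟙≤1 P? [] = z≤n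
  sum-𝟙≤1 P? {x ∷ _} (x#xs ∷ pairs) with P? x
  ... | yes px = s≤s (≤-reflexive (sum-𝟙≡0 P? (All.map (λ exclusive → exclusive px) x#xs)))
  ... | no _   = sum-𝟙≤1 P? pairs

  sum-map-+ : (g h : A → ℕ) (xs : List A) →
              sum (map (λ x → g x + h x) xs) ≡ sum (map g xs) + sum (map h xs)
  sum-map-+ g h []       = refl
  sum-map-+ g h (x ∷ xs) =
    trans (cong (g x + h x +_) (sum-map-+ g h xs)) (interchange (g x) (h x) _ _)

  sum-map-mono-≤ : {g h : A → ℕ} → (∀ x → g x ≤ h x) → (xs : List A) →
                   sum (map g xs) ≤ sum (map h xs)
  sum-map-mono-≤ g≤h []       = z≤n
  sum-map-mono-≤ g≤h (x ∷ xs) = +-mono-≤ (g≤h x) (sum-map-mono-≤ g≤h xs)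

  sum-map-const : (c : ℕ) (xs : List A) → sum (map (const c) xs) ≡ length xs * c
  sum-map-const c []       = refl
  sum-map-const c (x ∷ xs) = cong (c +_) (sum-map-const c xs)

  sum-map-sum-map : {B : Set} (h : B → A → ℕ) (os : List B) (xs : List A) →
                    sum (map (λ x → sum (map (λ o → h o x) os)) xs) ≡ sum (map (λ o → sum (map (h o) xs)) os)
  sum-map-sum-map h []       xs = trans (sum-map-const 0 xs) (*-zeroʳ (length xs))
  sum-map-sum-map h (o ∷ os) xs =
    trans (sum-map-+ (h o) (λ x → sum (map (λ o → h o x) os)) xs)
          (cong (sum (map (h o) xs) +_) (sum-map-sum-map h os xs))

∑ : (n : ℕ) → (Fin n → ℕ) → ℕ
∑ n g = sum (map g (allFin n))

∑-const : (n c : ℕ) → ∑ n (const c) ≡ n * c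
∑-const n c = trans (sum-map-const c (allFin n)) (cong (_* c) (length-tabulate {n = n} id))

module _ {n : ℕ} where

  private
    module Σ = CommutativeMonoidSum +-0-commutativeMonoid

    sum-tabulate : ∀ {m} (g : Fin m → ℕ) → sum (tabulate g) ≡ Σ.sum g
    sum-tabulate {zero}  g = refl
    sum-tabulate {suc m} g = cong (g Fin.zero +_) (sum-tabulate (g ∘ Fin.suc))

    ∑≡Σ : (g : Fin n → ℕ) → ∑ n g ≡ Σ.sum g
    ∑≡Σ g = trans (cong sum (map-tabulate id g)) (sum-tabulate g)

  ∑-permute : (g : Fin n → ℕ) (π π⁻¹ : Fin n → Fin n) →
              (∀ y → π (π⁻¹ y) ≡ y) → (∀ y → π⁻¹ (π y) ≡ y) → ∑ n (g ∘ π) ≡ ∑ n g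
  ∑-permute g π π⁻¹ inverseˡ inverseʳ = begin
    ∑ n (g ∘ π)      ≡⟨ ∑≡Σ (g ∘ π) ⟩
    Σ.sum (g ∘ π)    ≡⟨ Σ.sum-permute g (permutation π π⁻¹ inverseˡ inverseʳ) ⟨
    Σ.sum g          ≡⟨ ∑≡Σ g ⟨
    ∑ n g            ∎
    where open ≡-Reasoning

module Rotation (n : ℕ) .{{_ : NonZero n}} where

  rotate : ℕ → Fin n → Fin n
  rotate s x = modN n (toℕ x + s)

  toℕ-rotate : ∀ s x → toℕ (rotate s x) ≡ (toℕ x + s) % n
  toℕ-rotate s x = toℕ-fromℕ< _

  rotate-rotate : ∀ s t x → rotate t (rotate s x) ≡ rotate (s + t) x
  rotate-rotate s t x = toℕ-injective (begin
    toℕ (rotate t (rotate s x))        ≡⟨ toℕ-rotate t (rotate s x) ⟩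
    (toℕ (rotate s x) + t) % n         ≡⟨ cong (λ r → (r + t) % n) (toℕ-rotate s x) ⟩
    ((toℕ x + s) % n + t) % n          ≡⟨ %-distribˡ-+ ((toℕ x + s) % n) t n ⟩
    ((toℕ x + s) % n % n + t % n) % n  ≡⟨ cong (λ r → (r + t % n) % n) (m%n%n≡m%n (toℕ x + s) n) ⟩
    ((toℕ x + s) % n + t % n) % n      ≡⟨ %-distribˡ-+ (toℕ x + s) t n ⟨
    (toℕ x + s + t) % n                ≡⟨ cong (_% n) (+-assoc (toℕ x) s t) ⟩
    (toℕ x + (s + t)) % n              ≡⟨ toℕ-rotate (s + t) x ⟨
    toℕ (rotate (s + t) x)             ∎)
    where open ≡-Reasoning

  rotate-multiple : ∀ {s} x → n ∣ s → rotate s x ≡ x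
  rotate-multiple {s} x n∣s = toℕ-injective (begin
    toℕ (rotate s x)  ≡⟨ toℕ-rotate s x ⟩
    (toℕ x + s) % n   ≡⟨ %-remove-+ʳ (toℕ x) n∣s ⟩
    toℕ x % n         ≡⟨ m<n⇒m%n≡m (toℕ<n x) ⟩
    toℕ x             ∎)
    where open ≡-Reasoning

  rotate-zero : ∀ x → rotate 0 x ≡ x
  rotate-zero x = rotate-multiple x (n ∣0)

  rotate-inverse : ∀ {s t} x → n ∣ s + t → rotate t (rotate s x) ≡ x
  rotate-inverse {s} {t} x n∣s+t = trans (rotate-rotate s t x) (rotate-multiple x n∣s+t)

  rotate-complementʳ : ∀ {s} x → s ≤ n → rotate (n ∸ s) (rotate s x) ≡ x
  rotate-complementʳ x s≤n = rotate-inverse x (∣-reflexive (sym (m+[n∸m]≡n s≤n)))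

  rotate-complementˡ : ∀ {s} x → s ≤ n → rotate s (rotate (n ∸ s) x) ≡ x
  rotate-complementˡ x s≤n = rotate-inverse x (∣-reflexive (sym (m∸n+n≡m s≤n)))

  -- Rotating back by n ∸ toℕ x turns x + s into s + n.
  rotate-injectiveˡ : ∀ {s t} x → rotate s x ≡ rotate t x → s % n ≡ t % n
  rotate-injectiveˡ {s} {t} x eq = begin
    s % n            ≡⟨ back s ⟨
    toℕ (unshift s)  ≡⟨ cong (toℕ ∘ rotate (n ∸ toℕ x)) eq ⟩
    toℕ (unshift t)  ≡⟨ back t ⟩
    t % n            ∎
    where
    open ≡-Reasoning
    unshift : ℕ → Fin n
    unshift r = rotate (n ∸ toℕ x) (rotate r x)
    back : ∀ r → toℕ (unshift r) ≡ r % n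
    back r = begin
      toℕ (unshift r)                        ≡⟨ cong toℕ (rotate-rotate r (n ∸ toℕ x) x) ⟩
      toℕ (rotate (r + (n ∸ toℕ x)) x)       ≡⟨ toℕ-rotate (r + (n ∸ toℕ x)) x ⟩
      (toℕ x + (r + (n ∸ toℕ x))) % n        ≡⟨ cong (_% n) (x∙yz≈y∙xz (toℕ x) r _) ⟩
      (r + (toℕ x + (n ∸ toℕ x))) % n        ≡⟨ cong (λ m → (r + m) % n) (m+[n∸m]≡n (<⇒≤ (toℕ<n x))) ⟩
      (r + n) % n                            ≡⟨ [m+n]%n≡m%n r n ⟩
      r % n                                  ∎

  rotate-distinct : ∀ {s t} x → s < t → t < n → rotate s x ≢ rotate t x
  rotate-distinct {s} {t} x s<t t<n eq = <⇒≢ s<t (begin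
    s      ≡⟨ m<n⇒m%n≡m (<-trans s<t t<n) ⟨
    s % n  ≡⟨ rotate-injectiveˡ x eq ⟩
    t % n  ≡⟨ m<n⇒m%n≡m t<n ⟩
    t      ∎)
    where open ≡-Reasoning

  ∑-rotate : ∀ (g : Fin n → ℕ) s → ∑ n (g ∘ rotate s) ≡ ∑ n g
  ∑-rotate g s = ∑-permute g (rotate s) (rotate (pred n * s))
    (λ x → rotate-inverse x (subst (n ∣_) (+-comm s _) n∣s+s[n-1]))
    (λ x → rotate-inverse x n∣s+s[n-1])
    where
    n∣s+s[n-1] : n ∣ s + pred n * s
    n∣s+s[n-1] = subst (λ k → n ∣ k * s) (sym (suc-pred n)) (m∣m*n s)

any-∈ : ∀ {A : Set} (p : A → Bool) {x xs} → x ∈ xs → p x ≡ true → any p xs ≡ true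
any-∈ p {xs = _ ∷ xs} (here refl) px = cong (_∨ any p xs) px
any-∈ p {xs = y ∷ _} (there x∈xs) px = trans (cong (p y ∨_) (any-∈ p x∈xs px)) (∨-zeroʳ (p y))

module Distance (n a : ℕ) .{{_ : NonZero n}} where

  open Rotation n

  reach-refl : ∀ k u → reach n a k u u ≡ true
  reach-refl zero    u with u Fin.≟ u
  ... | yes _  = refl
  ... | no u≢u = contradiction refl u≢u
  reach-refl (suc k) u = cong (_∨ any (reach n a k u) (nbrs n a u)) (reach-refl k u)

  reach-step : ∀ k u {v w} → w ∈ nbrs n a v → reach n a k u w ≡ true → reach n a (suc k) u v ≡ true
  reach-step k u {v} w∈ r = trans (cong (reach n a k u v ∨_) (any-∈ (reach n a k u) w∈ r)) (∨-zeroʳ _)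

  distFrom-≤ : ∀ {m u v} fuel k → reach n a m u v ≡ true → k ≤ m → m < k + fuel →
               distFrom n a fuel k u v ≤ m
  distFrom-≤ {m} zero k _ k≤m m<k+0 = contradiction (subst (m <_) (+-identityʳ k) m<k+0) (≤⇒≯ k≤m)
  distFrom-≤ {m} {u} {v} (suc fuel) k r k≤m m<k+1+fuel with reach n a k u v in eq
  ... | true  = k≤m
  ... | false = distFrom-≤ fuel (suc k) r (≤∧≢⇒< k≤m k≢m) (subst (m <_) (+-suc k fuel) m<k+1+fuel)
    where
    k≢m : k ≢ m
    k≢m refl with trans (sym r) eq
    ... | ()

  dist-≤ : ∀ {k u v} → reach n a k u v ≡ true → k < n → dist n a u v ≤ k
  dist-≤ r k<n = distFrom-≤ n 0 r z≤n k<n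

  dist-adjacent : ∀ {u v} → 1 < n → u ∈ nbrs n a v → dist n a u v ≤ 1
  dist-adjacent {u} 1<n u∈ = dist-≤ (reach-step 0 u u∈ (reach-refl 0 u)) 1<n

  dist-common-nbr : ∀ {u v x} → 2 < n → u ∈ nbrs n a x → x ∈ nbrs n a v → dist n a u v ≤ 2
  dist-common-nbr {u} 2<n u∈ x∈ = dist-≤ (reach-step 1 u x∈ (reach-step 0 u u∈ (reach-refl 0 u))) 2<n

  nbrs-sym : ∀ {v w} → a ≤ n → w ∈ nbrs n a v → v ∈ nbrs n a w
  nbrs-sym {v} a≤n (here refl)                         = there (here (sym (rotate-complementʳ v (>-nonZero⁻¹ n))))
  nbrs-sym {v} a≤n (there (here refl))                 = here (sym (rotate-complementˡ v (>-nonZero⁻¹ n)))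
  nbrs-sym {v} a≤n (there (there (here refl)))         = there (there (there (here (sym (rotate-complementʳ v a≤n)))))
  nbrs-sym {v} a≤n (there (there (there (here refl)))) = there (there (here (sym (rotate-complementˡ v a≤n))))

independent-exclusive : ∀ {n a} .{{_ : NonZero n}} {f : Fin n → ℕ} → IsIndependent n a f →
                        ∀ {u v ℓ ℓ′} → u ≢ v → dist n a u v ≤ suc (ℓ ⊔ ℓ′) → ℓ < f u → ℓ′ < f v → ⊥
independent-exclusive independent u≢v d≤ ℓ<fu ℓ′<fv =
  <⇒≱ (independent _ _ u≢v (positive ℓ<fu) (positive ℓ′<fv)) (≤-trans d≤ (⊔-mono-≤ ℓ<fu ℓ′<fv))
  where
  positive : ∀ {ℓ m} → ℓ < m → 0 < m
  positive = ≤-trans (s≤s z≤n)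

countAbove : (n : ℕ) → (Fin n → ℕ) → ℕ → ℕ
countAbove n f ℓ = ∑ n (λ v → 𝟙 (ℓ <? f v))

module _ {n : ℕ} {f : Fin n → ℕ} (bounded : Is2Bounded n f) where

  cost≡countAbove0+countAbove1 : cost n f ≡ countAbove n f 0 + countAbove n f 1
  cost≡countAbove0+countAbove1 =
    trans (cong sum (map-cong (λ v → split (bounded v)) (allFin n)))
          (sum-map-+ _ _ (allFin n))
    where
    split : ∀ {m} → m ≤ 2 → m ≡ 𝟙 (0 <? m) + 𝟙 (1 <? m)
    split {0} _ = refl
    split {1} _ = refl
    split {2} _ = refl
    split {suc (suc (suc _))} (s≤s (s≤s ()))

  numTwo≡countAbove1 : numTwo n f ≡ countAbove n f 1
  numTwo≡countAbove1 =
    trans (length-filter≡sum-𝟙 _ (allFin n))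
          (cong sum (map-cong (λ v → two (bounded v)) (allFin n)))
    where
    two : ∀ {m} → m ≤ 2 → 𝟙 (m Data.Nat.≟ 2) ≡ 𝟙 (1 <? m)
    two {0} _ = refl
    two {1} _ = refl
    two {2} _ = refl
    two {suc (suc (suc _))} (s≤s (s≤s ()))

module Window (n a : ℕ) .{{_ : NonZero n}} (1<a : 1 < a) (a+a<n : a + a < n) (f : Fin n → ℕ) where

  open Rotation n
  open Distance n a

  private
    a≤n : a ≤ n
    a≤n = ≤-trans (m≤m+n a a) (<⇒≤ a+a<n)

    2<n : 2 < n
    2<n = ≤-trans (s≤s (≤-trans 1<a (m≤m+n a a))) a+a<n

    1<n : 1 < n
    1<n = <-trans (s≤s (s≤s z≤n)) 2<n

    a<n∸a : a < n ∸ a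
    a<n∸a = m+n≤o⇒m≤o∸n (suc a) a+a<n

    n∸a<n∸1 : n ∸ a < n ∸ 1
    n∸a<n∸1 = ∸-monoʳ-< 1<a a≤n

    n∸1<n : n ∸ 1 < n
    n∸1<n = ∸-monoʳ-< (s≤s z≤n) (>-nonZero⁻¹ n)

  -- (s , ℓ) stands for the vertex x + s, counted when f exceeds ℓ.
  window : List (ℕ × ℕ)
  window = (0 , 0) ∷ (1 , 1) ∷ (a , 1) ∷ (n ∸ a , 1) ∷ (n ∸ 1 , 0) ∷ []

  Occupied : Fin n → ℕ × ℕ → Set
  Occupied x (s , ℓ) = ℓ < f (rotate s x)

  occupied? : ∀ x → Decidable (Occupied x)
  occupied? x (s , ℓ) = ℓ <? f (rotate s x)

  charge : Fin n → ℕ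
  charge x = sum (map (𝟙 ∘ occupied? x) window)

  Ordered : ℕ × ℕ → ℕ × ℕ → Set
  Ordered (s , _) (t , _) = s < t × t < n

  ordered-trans : ∀ {p q r} → Ordered p q → Ordered q r → Ordered p r
  ordered-trans {_ , _} {_ , _} {_ , _} (p<q , _) (q<r , r<n) = <-trans p<q q<r , r<n

  window-ordered : AllPairs Ordered window
  window-ordered = Linked⇒AllPairs (λ {p q r} → ordered-trans {p} {q} {r})
    ((z<s , 1<n) ∷ (1<a , <-trans a<n∸a (<-trans n∸a<n∸1 n∸1<n)) ∷
     (a<n∸a , <-trans n∸a<n∸1 n∸1<n) ∷ (n∸a<n∸1 , n∸1<n) ∷ [-])

  Near : Fin n → ℕ × ℕ → ℕ × ℕ → Set
  Near x (s , ℓ) (t , ℓ′) = dist n a (rotate s x) (rotate t x) ≤ suc (ℓ ⊔ ℓ′)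

  window-near : ∀ x → AllPairs (Near x) window
  window-near x =
    (centre nbr₊₁ ∷ centre nbr₊ₐ ∷ centre nbr₋ₐ ∷ centre nbr₋₁ ∷ []) ∷
    (common nbr₊₁ nbr₊ₐ ∷ common nbr₊₁ nbr₋ₐ ∷ common nbr₊₁ nbr₋₁ ∷ []) ∷
    (common nbr₊ₐ nbr₋ₐ ∷ common nbr₊ₐ nbr₋₁ ∷ []) ∷
    (common nbr₋ₐ nbr₋₁ ∷ []) ∷ [] ∷ []
    where
    nbr₊₁ : rotate 1 x ∈ nbrs n a x
    nbr₊₁ = here refl
    nbr₋₁ : rotate (n ∸ 1) x ∈ nbrs n a x
    nbr₋₁ = there (here refl)
    nbr₊ₐ : rotate a x ∈ nbrs n a x
    nbr₊ₐ = there (there (here refl))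
    nbr₋ₐ : rotate (n ∸ a) x ∈ nbrs n a x
    nbr₋ₐ = there (there (there (here refl)))

    centre : ∀ {y ℓ} → y ∈ nbrs n a x → dist n a (rotate 0 x) y ≤ suc ℓ
    centre y∈ = subst (λ c → dist n a c _ ≤ _) (sym (rotate-zero x))
                      (≤-trans (dist-adjacent 1<n (nbrs-sym a≤n y∈)) (s≤s z≤n))

    common : ∀ {y z} → y ∈ nbrs n a x → z ∈ nbrs n a x → dist n a y z ≤ 2
    common y∈ z∈ = dist-common-nbr 2<n y∈ (nbrs-sym a≤n z∈)

  charge≤1 : IsIndependent n a f → ∀ x → charge x ≤ 1
  charge≤1 independent x =
    sum-𝟙≤1 (occupied? x) (AllPairs.zipWith separated (window-ordered , window-near x))
    where
    separated : ∀ {p q} → Ordered p q × Near x p q → Occupied x p → Occupied x q → ⊥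
    separated {_ , _} {_ , _} ((s<t , t<n) , near) =
      independent-exclusive independent (rotate-distinct x s<t t<n) near

  ∑-charge : ∑ n charge ≡ countAbove n f 0 * 2 + countAbove n f 1 * 3
  ∑-charge = begin
    ∑ n charge
      ≡⟨ sum-map-sum-map (λ p x → 𝟙 (occupied? x p)) window (allFin n) ⟩
    sum (map (λ p → ∑ n (λ x → 𝟙 (occupied? x p))) window)
      ≡⟨ cong sum (map-cong (λ (s , ℓ) → ∑-rotate (λ v → 𝟙 (ℓ <? f v)) s) window) ⟩
    sum (map (λ (_ , ℓ) → countAbove n f ℓ) window)
      ≡⟨ collect (countAbove n f 0) (countAbove n f 1) ⟩
    countAbove n f 0 * 2 + countAbove n f 1 * 3
      ∎
    where
    open ≡-Reasoning
    collect : ∀ p q → p + (q + (q + (q + (p + 0)))) ≡ p * 2 + q * 3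
    collect = solve-∀

  countAbove0*2+countAbove1*3≤n : IsIndependent n a f → countAbove n f 0 * 2 + countAbove n f 1 * 3 ≤ n
  countAbove0*2+countAbove1*3≤n independent = begin
    countAbove n f 0 * 2 + countAbove n f 1 * 3  ≡⟨ ∑-charge ⟨
    ∑ n charge                                   ≤⟨ sum-map-mono-≤ (charge≤1 independent) (allFin n) ⟩
    ∑ n (const 1)                                ≡⟨ ∑-const n 1 ⟩
    n * 1                                        ≡⟨ *-identityʳ n ⟩
    n                                            ∎
    where open ≤-Reasoning

m*2+k≤n⇒m≤[n∸k]/2 : ∀ {m k n} → m * 2 + k ≤ n → m ≤ (n ∸ k) / 2
m*2+k≤n⇒m≤[n∸k]/2 {m} {k} {n} m*2+k≤n = begin
  m            ≡⟨ m*n/n≡m m 2 ⟨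
  m * 2 / 2    ≤⟨ /-monoˡ-≤ 2 (m+n≤o⇒m≤o∸n (m * 2) m*2+k≤n) ⟩
  (n ∸ k) / 2  ∎
  where open ≤-Reasoning

proposition11 : (n a : ℕ) → .{{_ : NonZero n}} →
    3 ≤ a → a ≤ n / 2 → 3 * a ≤ n →
    (f : Fin n → ℕ) → IsBroadcast n a f → IsIndependent n a f → Is2Bounded n f →
    cost n f ≤ (n ∸ numTwo n f) / 2
proposition11 n a 3≤a _ 3a≤n f _ independent bounded = m*2+k≤n⇒m≤[n∸k]/2 (begin
  cost n f * 2 + numTwo n f
    ≡⟨ cong₂ (λ c t → c * 2 + t) (cost≡countAbove0+countAbove1 bounded) (numTwo≡countAbove1 bounded) ⟩
  (countAbove n f 0 + countAbove n f 1) * 2 + countAbove n f 1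
    ≡⟨ regroup (countAbove n f 0) (countAbove n f 1) ⟩
  countAbove n f 0 * 2 + countAbove n f 1 * 3
    ≤⟨ Window.countAbove0*2+countAbove1*3≤n n a 1<a a+a<n f independent ⟩
  n ∎)
  where
  open ≤-Reasoning
  regroup : ∀ p q → (p + q) * 2 + q ≡ p * 2 + q * 3
  regroup = solve-∀
  tripling : ∀ p → p + p + p ≡ 3 * p
  tripling = solve-∀
  1<a : 1 < a
  1<a = ≤-trans (s≤s (s≤s z≤n)) 3≤a
  a+a<n : a + a < n
  a+a<n = begin-strict
    a + a      <⟨ m<m+n (a + a) (<-trans (s≤s z≤n) 1<a) ⟩
    a + a + a  ≡⟨ tripling a ⟩
    3 * a      ≤⟨ 3a≤n ⟩
    n          ∎
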